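{- Let $T$ be a tree with maximal valence $k$ (a finite positive integer). Suppose $T$ has a vertex $v$ with $1 \leq \operatorname{val}(v) \leq k-1$. Then $\operatorname{D}(A(T)_v) \leq k-1$; that is, there is a $(k-1)$-coloring $\mathfrak{c}$ of the vertices of $T$ such that the only automorphism in $A(T)_v$ preserving $\mathfrak{c}$ is the identity.
   Context: $A(T)$ denotes the automorphism group of $T$ and $A(T)_v=\{\alpha\in A(T) : \alpha(v)=v\}$ the stabilizer of $v$. A $d$-coloring is a map from the vertex set to $\{1,\dots,d\}$; an automorphism $\varphi$ preserves a coloring $\mathfrak{c}$ if $\mathfrak{c}(\varphi(x))=\mathfrak{c}(x)$ for all vertices $x$. For a group $\Gamma$ of automorphisms, $\operatorname{D}(\Gamma)$ is the least $d$ such that some $d$-coloring is preserved by no non-identity element of $\Gamma$. $\operatorname{val}(v)$ is the valence (degree) of $v$. -}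

module Defs where

open import Data.Bool using (Bool; true; false)
open import Data.Nat using (ℕ; _≤_)
open import Data.Fin using (Fin)
open import Data.List using (List; []; _∷_; length; _∷ʳ_)
open import Data.List.Relation.Unary.Unique.Propositional using (Unique)
open import Data.List.Relation.Unary.Linked using (Linked)
open import Data.Product using (Σ; _×_)
open import Function.Bundles using (_↔_; Inverse)
open import Relation.Binary.PropositionalEquality using (_≡_)
open import Relation.Nullary using (¬_)

module _ {V : Set} (adj : V → V → Bool) where

  Adj : V → V → Set
  Adj x y = adj x y ≡ true

  data Walk : V → V → Set where
    nil  : ∀ {x} → Walk x x
    cons : ∀ {x y z} → Adj x y → Walk y z → Walk x z

  Cycle : Set
  Cycle = Σ V λ x → Σ (List V) λ ys →
            (3 ≤ length (x ∷ ys)) × Unique (x ∷ ys) × Linked Adj ((x ∷ ys) ∷ʳ x)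

  record IsTree : Set where
    field
      symmetric   : ∀ x y → adj x y ≡ adj y x
      irreflexive : ∀ x → adj x x ≡ false
      connected   : ∀ x y → Walk x y
      acyclic     : ¬ Cycle

  Neighbours : V → Set
  Neighbours v = Σ V λ w → Adj v w

  HasValence : V → ℕ → Set
  HasValence v n = Neighbours v ↔ Fin n

  MaxValence : ℕ → Set
  MaxValence k = (∀ x → Σ ℕ λ n → (n ≤ k) × HasValence x n) × (Σ V λ u → HasValence u k)

  IsAut : (V ↔ V) → Set
  IsAut f = ∀ x y → adj (Inverse.to f x) (Inverse.to f y) ≡ adj x y

module Submission where

-- Each
-- vertex x is joined to v by a unique non-backtracking walk, its geodesic.
-- Colour a neighbour x of v by the position of x among the neighbours of v,
-- and a vertex x whose geodesic starts x, y, z by the position of x among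
-- the (at most k ∸ 1) neighbours of y other than z.  Then the children of
-- each vertex get distinct colours, so an automorphism fixing v and the
-- colours fixes every vertex, by induction along geodesics towards x.

open import Data.Bool using (Bool)
open import Data.Bool.Properties using () renaming (_≟_ to _≟ᵇ_)
open import Data.Nat using (ℕ; suc; _≤_; _∸_; s≤s; z≤n)
open import Data.Nat.Properties using (≤-trans; ∸-monoˡ-≤)
open import Data.Fin using (Fin; inject≤; punchOut; fromℕ<)
open import Data.Fin.Properties using (inject≤-injective; punchOut-injective; punchOut-cong)
  renaming (_≟_ to _≟ᶠ_)
open import Data.Product using (Σ; _,_; proj₁; proj₂; _×_)
open import Data.Empty using (⊥; ⊥-elim)
open import Data.Unit using (⊤; tt)
open import Data.List using (List; []; _∷_; _++_; _ʳ++_)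
open import Data.List.Relation.Unary.Linked using (Linked; []; [-]; _∷_)
open import Data.List.Relation.Unary.All as All using (All; []; _∷_)
open import Data.List.Relation.Unary.All.Properties using (¬Any⇒All¬; ++⁻ˡ)
open import Data.List.Relation.Unary.Any using (here; there)
open import Data.List.Relation.Unary.AllPairs using ([]; _∷_)
open import Data.List.Relation.Unary.Unique.Propositional using (Unique)
open import Data.List.Membership.Propositional using (_∈_)
open import Data.List.Membership.Propositional.Properties using (∈-∃++; ∈-++⁺ʳ)
open import Function.Bundles using (_↔_; Inverse; Injection)
open import Function.Properties.Inverse using (↔⇒↣)
open import Relation.Binary.PropositionalEquality
  using (_≡_; _≢_; refl; sym; trans; cong; subst; module ≡-Reasoning)
open import Relation.Nullary using (¬_; Dec; yes; no)
open import Relation.Nullary.Decidable.Core using (¬¬-excluded-middle)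
open import Axiom.UniquenessOfIdentityProofs using (module Decidable⇒UIP)
open import Defs

↔-injective : {A B : Set} (f : A ↔ B) {a b : A} → Inverse.to f a ≡ Inverse.to f b → a ≡ b
↔-injective f = Injection.injective (↔⇒↣ f)

bool-uip : {a b : Bool} (p q : a ≡ b) → p ≡ q
bool-uip = Decidable⇒UIP.≡-irrelevant _≟ᵇ_

unique-rotate : {A : Set} (ys : List A) (x : A) (zs : List A) → Unique (ys ++ x ∷ zs) → Unique (x ∷ ys)
unique-rotate []       x zs _           = [] ∷ []
unique-rotate (y ∷ ys) x zs (y∉ ∷ uniq) with unique-rotate ys x zs uniq
... | x∉ys ∷ uniq-ys =
  ((λ x≡y → All.lookup y∉ (∈-++⁺ʳ ys (here refl)) (sym x≡y)) ∷ x∉ys) ∷ (++⁻ˡ ys y∉ ∷ uniq-ys)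

ʳ++-unique-suffix : {A : Set} (xs ys : List A) → Unique (xs ʳ++ ys) → Unique ys
ʳ++-unique-suffix []       ys uniq = uniq
ʳ++-unique-suffix (x ∷ xs) ys uniq with ʳ++-unique-suffix xs (x ∷ ys) uniq
... | _ ∷ uniq-ys = uniq-ys

ʳ++-repeats : {A : Set} {b : A} (xs ys : List A) → Unique (xs ʳ++ ys) → b ∈ xs → b ∈ ys → ⊥
ʳ++-repeats (x ∷ xs) ys uniq (here refl) b∈ys with ʳ++-unique-suffix xs (x ∷ ys) uniq
... | x∉ys ∷ _ = All.lookup x∉ys b∈ys refl
ʳ++-repeats (x ∷ xs) ys uniq (there b∈xs) b∈ys = ʳ++-repeats xs (x ∷ ys) uniq b∈xs (there b∈ys)

linked-tail : {A : Set} {R : A → A → Set} {x : A} {l : List A} → Linked R (x ∷ l) → Linked R l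
linked-tail [-]     = []
linked-tail (_ ∷ l) = l

linked-prefix : {A : Set} {R : A → A → Set} (x : A) (ys : List A) (c : A) (zs : List A) →
                Linked R (x ∷ ys ++ c ∷ zs) → Linked R (x ∷ ys ++ c ∷ [])
linked-prefix x []       c zs (r ∷ _) = r ∷ [-]
linked-prefix x (y ∷ ys) c zs (r ∷ l) = r ∷ linked-prefix y ys c zs l

labelAvoiding : ∀ {k m} → m ≤ k → (j i : Fin m) → j ≢ i → Fin (k ∸ 1)
labelAvoiding {m = suc m} m≤k j i j≢i = inject≤ (punchOut j≢i) (∸-monoˡ-≤ 1 m≤k)

labelAvoiding-injective : ∀ {k m} (m≤k : m ≤ k) (j : Fin m) {i i′ : Fin m}
                          (j≢i : j ≢ i) (j≢i′ : j ≢ i′) →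
                          labelAvoiding m≤k j i j≢i ≡ labelAvoiding m≤k j i′ j≢i′ → i ≡ i′
labelAvoiding-injective {m = suc m} m≤k j j≢i j≢i′ same =
  punchOut-injective j≢i j≢i′ (inject≤-injective _ _ _ _ same)

labelAvoiding-irrelevant : ∀ {k m} (m≤k : m ≤ k) (j i : Fin m) (j≢i j≢i′ : j ≢ i) →
                           labelAvoiding m≤k j i j≢i ≡ labelAvoiding m≤k j i j≢i′
labelAvoiding-irrelevant {m = suc m} m≤k j i j≢i j≢i′ =
  cong (λ l → inject≤ l (∸-monoˡ-≤ 1 m≤k)) (punchOut-cong j refl)

module Walks {V : Set} (adj : V → V → Bool) where

  infix 4 _~_
  _~_ : V → V → Set
  _~_ = Adj adj

  -- The vertex list x ∷ … ∷ y of a walk from x to y.  It is defined through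
  -- the list of vertices after the start, so that it is visibly non-empty.
  vertices      : ∀ {x y} → Walk adj x y → List V
  verticesAfter : ∀ {x y} → Walk adj x y → List V
  vertices {x} w = x ∷ verticesAfter w
  verticesAfter nil        = []
  verticesAfter (cons _ w) = vertices w

  vertices-linked : ∀ {x y} (w : Walk adj x y) → Linked _~_ (vertices w)
  vertices-linked nil                 = [-]
  vertices-linked (cons p nil)        = p ∷ [-]
  vertices-linked (cons p (cons q w)) = p ∷ vertices-linked (cons q w)

  end∈vertices : ∀ {x y} (w : Walk adj x y) → y ∈ vertices w
  end∈vertices nil        = here refl
  end∈vertices (cons _ w) = there (end∈vertices w)

  data NonBacktracking : List V → Set where
    nb-one  : ∀ {x} → NonBacktracking (x ∷ [])
    nb-two  : ∀ {x y} → NonBacktracking (x ∷ y ∷ [])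
    nb-cons : ∀ {x y z l} → x ≢ z → NonBacktracking (y ∷ z ∷ l) →
              NonBacktracking (x ∷ y ∷ z ∷ l)

  nb-tail : ∀ {x y l} → NonBacktracking (x ∷ y ∷ l) → NonBacktracking (y ∷ l)
  nb-tail nb-two         = nb-one
  nb-tail (nb-cons _ nb) = nb

  DecidableNeighbours : Set
  DecidableNeighbours = ∀ {a y y′} → a ~ y → a ~ y′ → Dec (y ≡ y′)

  finite-valence⇒decidable : (∀ x → Σ ℕ (HasValence adj x)) → DecidableNeighbours
  finite-valence⇒decidable valence {a} {y} {y′} p p′
    with Inverse.to (proj₂ (valence a)) (y , p) ≟ᶠ Inverse.to (proj₂ (valence a)) (y′ , p′)
  ... | yes same = yes (cong proj₁ (↔-injective (proj₂ (valence a)) same))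
  ... | no  diff = no λ { refl → diff (cong (λ q → Inverse.to (proj₂ (valence a)) (y , q)) (bool-uip p p′)) }

module Trees {V : Set} {adj : V → V → Bool} (tree : IsTree adj) where
  open Walks adj
  open IsTree tree

  ~-sym : ∀ {x y} → x ~ y → y ~ x
  ~-sym {x} {y} p = trans (symmetric y x) p

  -- A non-backtracking walk x ∷ l cannot return to x while its later
  -- vertices are distinct: the first return closes a cycle, which has at
  -- least three vertices since there are no loops and no backtracking.
  no-return : ∀ x l → Linked _~_ (x ∷ l) → NonBacktracking (x ∷ l) → Unique l → x ∈ l → ⊥
  no-return x l linked nb uniq x∈l with ∈-∃++ x∈l
  no-return x l (x~x ∷ _) nb uniq x∈l | [] , zs , refl
    with () ← trans (sym x~x) (irreflexive x)
  no-return x l linked (nb-cons x≢x _) uniq x∈l | _ ∷ [] , zs , refl = x≢x refl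
  no-return x l linked nb uniq x∈l | y ∷ y′ ∷ ys , zs , refl =
    acyclic (x , y ∷ y′ ∷ ys , s≤s (s≤s (s≤s z≤n)) ,
             unique-rotate (y ∷ y′ ∷ ys) x zs uniq , linked-prefix x (y ∷ y′ ∷ ys) x zs linked)

  -- The
  -- vertices are not known to have decidable equality, so we only get this
  -- under a double negation, which suffices for deriving contradictions.
  nb-distinct : ∀ l → Linked _~_ l → NonBacktracking l → ¬ ¬ Unique l
  nb-distinct []          _      _  ¬uniq = ¬uniq []
  nb-distinct (x ∷ [])    _      _  ¬uniq = ¬uniq ([] ∷ [])
  nb-distinct (x ∷ y ∷ l) linked nb ¬uniq =
    nb-distinct (y ∷ l) (linked-tail linked) (nb-tail nb) λ uniq →
      ¬¬-excluded-middle λ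
        { (yes x∈l) → no-return x (y ∷ l) linked nb uniq x∈l
        ; (no x∉l)  → ¬uniq (¬Any⇒All¬ _ x∉l ∷ uniq) }

  no-closed-walk : ∀ {a y} (p : a ~ y) (w : Walk adj y a) → ¬ NonBacktracking (vertices (cons p w))
  no-closed-walk p w nb =
    nb-distinct _ (vertices-linked (cons p w)) nb λ { (a∉ ∷ _) → All.lookup a∉ (end∈vertices w) refl }

  HeadsDiffer : List V → List V → Set
  HeadsDiffer (u ∷ _) (w ∷ _) = u ≢ w
  HeadsDiffer _       _       = ⊤

  reverse-join : ∀ xs y acc →
                 Linked _~_ (y ∷ xs) → NonBacktracking (y ∷ xs) →
                 Linked _~_ (y ∷ acc) → NonBacktracking (y ∷ acc) → HeadsDiffer xs acc →
                 Linked _~_ (xs ʳ++ y ∷ acc) × NonBacktracking (xs ʳ++ y ∷ acc)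
  reverse-join []       y acc _      _   linked nb _ = linked , nb
  reverse-join (x ∷ xs) y acc linked₁ nb₁ linked₂ nb₂ x≢a =
    reverse-join xs x (y ∷ acc) (linked-tail linked₁) (nb-tail nb₁)
      (~-sym (head linked₁) ∷ linked₂) (extend acc nb₂ x≢a) (turn xs nb₁)
    where
      head : ∀ {l} → Linked _~_ (y ∷ x ∷ l) → y ~ x
      head (p ∷ _) = p
      extend : ∀ acc → NonBacktracking (y ∷ acc) → HeadsDiffer (x ∷ xs) acc →
               NonBacktracking (x ∷ y ∷ acc)
      extend []      _  _   = nb-two
      extend (_ ∷ _) nb x≢a = nb-cons x≢a nb
      turn : ∀ xs → NonBacktracking (y ∷ x ∷ xs) → HeadsDiffer xs (y ∷ acc)
      turn []      _               = tt
      turn (_ ∷ _) (nb-cons y≢u _) = λ u≡y → y≢u (sym u≡y)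

  data SameFirstStep : ∀ {a b} → Walk adj a b → Walk adj a b → Set where
    both-nil  : ∀ {a} → SameFirstStep (nil {x = a}) nil
    both-cons : ∀ {a b y} (p p′ : a ~ y) (w w′ : Walk adj y b) → SameFirstStep (cons p w) (cons p′ w′)

  module _ (_≟ₙ_ : DecidableNeighbours) where

    -- In a tree, two non-backtracking walks with the same ends take the same
    -- first step: otherwise one reversed, followed by the other, would be a
    -- non-backtracking walk repeating its end vertex.
    first-step-unique : ∀ {a b} (w₁ w₂ : Walk adj a b) →
                        NonBacktracking (vertices w₁) → NonBacktracking (vertices w₂) → SameFirstStep w₁ w₂
    first-step-unique nil         nil         _   _   = both-nil
    first-step-unique nil         (cons p w)  _   nb₂ = ⊥-elim (no-closed-walk p w nb₂)
    first-step-unique (cons p w)  nil         nb₁ _   = ⊥-elim (no-closed-walk p w nb₁)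
    first-step-unique {a} (cons p₁ w₁) (cons p₂ w₂) nb₁ nb₂ with p₁ ≟ₙ p₂
    ... | yes refl = both-cons p₁ p₂ w₁ w₂
    ... | no y₁≢y₂ =
      ⊥-elim (nb-distinct _ linked nb λ uniq →
                ʳ++-repeats (vertices w₁) (a ∷ vertices w₂) uniq (end∈vertices w₁) (there (end∈vertices w₂)))
      where
        joined = reverse-join (vertices w₁) a (vertices w₂)
                   (vertices-linked (cons p₁ w₁)) nb₁ (vertices-linked (cons p₂ w₂)) nb₂ y₁≢y₂
        linked = proj₁ joined
        nb     = proj₂ joined

    -- Every walk can be pruned to a non-backtracking walk with the same ends,
    -- by cancelling each step that immediately returns along the previous edge.
    prune : ∀ {x b} → Walk adj x b → Σ (Walk adj x b) λ r → NonBacktracking (vertices r)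
    prune nil = nil , nb-one
    prune (cons p w) with prune w
    ... | nil , _ = cons p nil , nb-two
    ... | cons q r , nb with ~-sym p ≟ₙ q
    ...   | yes refl = r , nb-tail nb
    ...   | no  x≢z  = cons p (cons q r) , nb-cons x≢z nb

module Colouring {V : Set} {adj : V → V → Bool} (tree : IsTree adj) (k : ℕ)
                 (valence : ∀ x → Σ ℕ λ m → (m ≤ k) × HasValence adj x m)
                 (v : V) {n : ℕ} (index-v : HasValence adj v n) (n≤k∸1 : n ≤ k ∸ 1)
                 (colour-v : Fin (k ∸ 1)) where
  open Walks adj
  open Trees tree
  open ≡-Reasoning

  _≟ₙ_ : DecidableNeighbours
  _≟ₙ_ = finite-valence⇒decidable λ x → proj₁ (valence x) , proj₂ (proj₂ (valence x))

  position : ∀ {x y} → x ~ y → Fin (proj₁ (valence y))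
  position {x} {y} p = Inverse.to (proj₂ (proj₂ (valence y))) (x , ~-sym p)

  position-injective : ∀ {x x′ y} (p : x ~ y) (p′ : x′ ~ y) → position p ≡ position p′ → x ≡ x′
  position-injective {y = y} p p′ same = cong proj₁ (↔-injective (proj₂ (proj₂ (valence y))) same)

  rootColour : ∀ {x} → x ~ v → Fin (k ∸ 1)
  rootColour {x} p = inject≤ (Inverse.to index-v (x , ~-sym p)) n≤k∸1

  rootColour-injective : ∀ {x x′} (p : x ~ v) (p′ : x′ ~ v) → rootColour p ≡ rootColour p′ → x ≡ x′
  rootColour-injective p p′ same = cong proj₁ (↔-injective index-v (inject≤-injective _ _ _ _ same))

  childColour : ∀ {x y z} → x ~ y → y ~ z → x ≢ z → Fin (k ∸ 1)
  childColour {y = y} p q x≢z =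
    labelAvoiding (proj₁ (proj₂ (valence y))) (position (~-sym q)) (position p)
      λ same → x≢z (sym (position-injective (~-sym q) p same))

  childColour-injective : ∀ {x x′ y z} (p : x ~ y) (p′ : x′ ~ y) (q : y ~ z) (x≢z : x ≢ z) (x′≢z : x′ ≢ z) →
                          childColour p q x≢z ≡ childColour p′ q x′≢z → x ≡ x′
  childColour-injective {y = y} p p′ q _ _ same =
    position-injective p p′ (labelAvoiding-injective (proj₁ (proj₂ (valence y))) _ _ _ same)

  childColour-irrelevant : ∀ {x y z} (p p′ : x ~ y) (q q′ : y ~ z) (x≢z x≢z′ : x ≢ z) →
                           childColour p q x≢z ≡ childColour p′ q′ x≢z′
  childColour-irrelevant {y = y} p p′ q q′ _ _ rewrite bool-uip p p′ | bool-uip q q′ =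
    labelAvoiding-irrelevant (proj₁ (proj₂ (valence y))) _ _ _ _

  walkColour : ∀ {x} (ρ : Walk adj x v) → NonBacktracking (vertices ρ) → Fin (k ∸ 1)
  walkColour nil                 _               = colour-v
  walkColour (cons p nil)        _               = rootColour p
  walkColour (cons p (cons q _)) (nb-cons x≢z _) = childColour p q x≢z

  -- The walk colour does not depend on the walk: by uniqueness of first
  -- steps, two non-backtracking walks to v share their first two steps.
  walkColour-unique : ∀ {x} (ρ ρ′ : Walk adj x v) (nb : NonBacktracking (vertices ρ))
                      (nb′ : NonBacktracking (vertices ρ′)) → walkColour ρ nb ≡ walkColour ρ′ nb′
  walkColour-unique ρ ρ′ nb nb′ with first-step-unique _≟ₙ_ ρ ρ′ nb nb′
  ... | both-nil = refl
  ... | both-cons p p′ w w′ = second-step w w′ nb nb′ (first-step-unique _≟ₙ_ w w′ (nb-tail nb) (nb-tail nb′))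
    where
      second-step : ∀ {y} {p p′ : _ ~ y} (w w′ : Walk adj y v) (nb : NonBacktracking (vertices (cons p w)))
                    (nb′ : NonBacktracking (vertices (cons p′ w′))) → SameFirstStep w w′ →
                    walkColour (cons p w) nb ≡ walkColour (cons p′ w′) nb′
      second-step {p = p} {p′} _ _ _ _ both-nil = cong rootColour (bool-uip p p′)
      second-step {p = p} {p′} _ _ (nb-cons x≢z _) (nb-cons x≢z′ _) (both-cons q q′ _ _) =
        childColour-irrelevant p p′ q q′ x≢z x≢z′

  geodesic : ∀ x → Σ (Walk adj x v) λ ρ → NonBacktracking (vertices ρ)
  geodesic x = prune _≟ₙ_ (IsTree.connected tree x v)

  colour : V → Fin (k ∸ 1)
  colour x = walkColour (proj₁ (geodesic x)) (proj₂ (geodesic x))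

  colour-along : ∀ {x} (ρ : Walk adj x v) (nb : NonBacktracking (vertices ρ)) → colour x ≡ walkColour ρ nb
  colour-along {x} ρ nb = walkColour-unique (proj₁ (geodesic x)) ρ (proj₂ (geodesic x)) nb

  siblings-distinct : ∀ {x x′ y} (p : x ~ y) (p′ : x′ ~ y) (w : Walk adj y v)
                      (nb : NonBacktracking (vertices (cons p w))) (nb′ : NonBacktracking (vertices (cons p′ w))) →
                      walkColour (cons p w) nb ≡ walkColour (cons p′ w) nb′ → x ≡ x′
  siblings-distinct p p′ nil        _               _                same = rootColour-injective p p′ same
  siblings-distinct p p′ (cons q _) (nb-cons x≢z _) (nb-cons x′≢z _) same =
    childColour-injective p p′ q x≢z x′≢z same

  module Rigidity (F : V → V) (F-injective : ∀ {x y} → F x ≡ F y → x ≡ y)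
                  (F-adjacent : ∀ {x y} → x ~ y → F x ~ F y) (F-v : F v ≡ v)
                  (F-colour : ∀ x → colour (F x) ≡ colour x) where

    Fixed : V → Set
    Fixed u = F u ≡ u

    moved-start : ∀ {x y} (p : x ~ y) (p′ : F x ~ y) (w : Walk adj y v) →
                  NonBacktracking (vertices (cons p w)) → All Fixed (vertices w) →
                  NonBacktracking (vertices (cons p′ w))
    moved-start p p′ nil        _               _              = nb-two
    moved-start p p′ (cons q w) (nb-cons x≢z nb) (_ ∷ Fz≡z ∷ _) =
      nb-cons (λ Fx≡z → x≢z (F-injective (trans Fx≡z (sym Fz≡z)))) nb

    -- F fixes every vertex of a non-backtracking walk to v, by induction
    -- from v: a fixed vertex y with fixed parent has its children permuted by
    -- F, with colours preserved, hence fixed.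
    fixes-walk : ∀ {x} (ρ : Walk adj x v) → NonBacktracking (vertices ρ) → All Fixed (vertices ρ)
    fixes-walk nil                    _  = F-v ∷ []
    fixes-walk {x} (cons {y = y} p w) nb = Fx≡x ∷ fixed-w
      where
        fixed-w = fixes-walk w (nb-tail nb)
        p′ : F x ~ y
        p′ = subst (F x ~_) (All.head fixed-w) (F-adjacent p)
        nb′ = moved-start p p′ w nb fixed-w
        Fx≡x : F x ≡ x
        Fx≡x = siblings-distinct p′ p w nb′ nb (begin
          walkColour (cons p′ w) nb′ ≡⟨ sym (colour-along (cons p′ w) nb′) ⟩
          colour (F x)               ≡⟨ F-colour x ⟩
          colour x                   ≡⟨ colour-along (cons p w) nb ⟩
          walkColour (cons p w) nb   ∎)

    fixes-all : ∀ x → F x ≡ x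
    fixes-all x = All.head (fixes-walk (proj₁ (geodesic x)) (proj₂ (geodesic x)))

lemma1 : (V : Set) (adj : V → V → Bool) → IsTree adj →
         (k : ℕ) → 1 ≤ k → MaxValence adj k →
         (v : V) (n : ℕ) → HasValence adj v n → 1 ≤ n → n ≤ k ∸ 1 →
         Σ (V → Fin (k ∸ 1)) λ c →
           (f : V ↔ V) → IsAut adj f → Inverse.to f v ≡ v →
           (∀ x → c (Inverse.to f x) ≡ c x) →
           ∀ x → Inverse.to f x ≡ x
lemma1 V adj tree k _ maxValence v n index-v 1≤n n≤k∸1 =
  colour , λ f aut f-v f-colour →
    Rigidity.fixes-all (Inverse.to f) (↔-injective f) (λ {x} {y} p → trans (aut x y) p) f-v f-colour
  where
    -- k ∸ 1 ≥ n ≥ 1, so there is a colour available for v itself.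
    open Colouring tree k (proj₁ maxValence) v index-v n≤k∸1 (fromℕ< (≤-trans 1≤n n≤k∸1))
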